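{- For every grammar $G$ of a non-empty string $w$, $|\mathit{gfact}(G)| - 1 + \sigma_w \le |G|$, where $\sigma_w$ is the number of distinct symbols occurring in $w$.
   Context: A grammar $G$ of $w$ is a straight-line program: a context-free grammar in Chomsky normal form with productions $X_i\to\alpha$ ($\alpha$ terminal) or $X_i\to X_jX_k$ ($j,k<i$) deriving exactly $w$; $|G|$ is its number of productions. The derivation tree $\mathcal{T}(G)$ has internal nodes labeled by non-terminals; each terminal leaf is identified with its parent, so $\mathcal{T}(G)$ is a full binary tree. The partial derivation tree $\mathcal{PT}(G)$ is the maximal subgraph of $\mathcal{T}(G)$ (containing the root, closed under taking parents) such that for each non-leaf node $v$ of $\mathcal{PT}(G)$ there is no node with the same label as $v$ to the left of $v$ (i.e. occurring earlier in preorder); equivalently, it is obtained by cutting off the descendants of every node whose label already appeared at an earlier node. The g-factorization $\mathit{gfact}(G)$ is the factorization of $w$ whose phrases are the strings derived by the leaves of $\mathcal{PT}(G)$, from left to right; $|\mathit{gfact}(G)|$ is its number of phrases. -}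

module Defs where

open import Data.Nat using (ℕ; zero; suc)
open import Data.Fin using (Fin)
open import Data.Vec using (Vec; []; _∷ʳ_; lookup; last)
open import Data.List using (List; []; _∷_; _++_; [_]; length; deduplicate)
open import Data.Product using (_×_; _,_)
open import Data.Nat.Properties using (_≟_)
open import Data.List.Membership.DecPropositional _≟_ using (_∈?_)
open import Relation.Nullary using (yes; no)
open import Relation.Binary.Definitions using (DecidableEquality)

data Rule (A : Set) (i : ℕ) : Set where
  term : A → Rule A i
  bin  : Fin i → Fin i → Rule A i

-- A straight-line program with n productions X_0, ..., X_{n-1};
-- G ▷ r appends the production X_n → r.
data SLP (A : Set) : ℕ → Set where
  []  : SLP A 0
  _▷_ : ∀ {n} → SLP A n → Rule A n → SLP A (suc n)

size : ∀ {A n} → SLP A n → ℕ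
size {n = n} _ = n

-- Derivation trees; nodes labelled by non-terminal indices.  A terminal leaf is
-- identified with its parent (tleaf X a is the node X with production X → a).
data DTree (A : Set) : Set where
  tleaf : ℕ → A → DTree A
  tnode : ℕ → DTree A → DTree A → DTree A

label : ∀ {A} → DTree A → ℕ
label (tleaf X _)   = X
label (tnode X _ _) = X

yield : ∀ {A} → DTree A → List A
yield (tleaf _ a)   = a ∷ []
yield (tnode _ l r) = yield l ++ yield r

trees : ∀ {A n} → SLP A n → Vec (DTree A) n
trees []                    = []
trees {n = suc n} (G ▷ r) = ts ∷ʳ mk r
  where
  ts = trees G
  mk : Rule _ n → DTree _
  mk (term a)  = tleaf n a
  mk (bin j k) = tnode n (lookup ts j) (lookup ts k)

derivTree : ∀ {A n} → SLP A (suc n) → DTree A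
derivTree G = last (trees G)

Derives : ∀ {A n} → SLP A (suc n) → List A → Set
Derives G w = yield (derivTree G) ≡ w
  where open import Relation.Binary.PropositionalEquality using (_≡_)

-- Preorder traversal of T(G), threading the set of labels already seen:
-- a node whose label was already seen is a leaf of PT(G) (its subtree is cut);
-- terminal nodes are leaves of PT(G); returns the phrases (leaf yields), left to right.
gfactGo : ∀ {A} → List ℕ → DTree A → List ℕ × List (List A)
gfactGo s t with label t ∈? s
... | yes _ = s , [ yield t ]
gfactGo s (tleaf X a)   | no _ = X ∷ s , [ a ∷ [] ]
gfactGo s (tnode X l r) | no _ with gfactGo (X ∷ s) l
... | s₁ , p₁ with gfactGo s₁ r
... | s₂ , p₂ = s₂ , p₁ ++ p₂

gfact : ∀ {A n} → SLP A (suc n) → List (List A)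
gfact {A} G with gfactGo {A} [] (derivTree G)
... | _ , ps = ps

σ : {A : Set} → DecidableEquality A → List A → ℕ
σ _≟A_ w = length (deduplicate _≟A_ w)

{-# OPTIONS --safe #-}
-- Walk T(G) in preorder as gfact does, keeping the list s of labels seen so far.
-- A label enters s exactly once, at an internal node or at a terminal leaf of
-- PT(G); since PT(G) is a full binary tree with |gfact G| leaves, this gives
-- |gfact G| − 1 + #(terminal leaves of PT(G)) = |s| ≤ |G|.  Every symbol of w
-- occurs at a terminal leaf of PT(G): in a grammar the label of a node
-- determines its subtree, so a cut node repeats an earlier, already finished
-- subtree (it cannot repeat one of its own ancestors) whose symbols were
-- already met.
module Submission where

open import Defs
open import Data.Nat using (ℕ; suc; _+_; _∸_; _≤_; _<_; z≤n; s≤s)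
open import Data.Nat.Properties
  using (_≟_; ≤-refl; ≤-trans; ≤-reflexive; <-irrefl; m<n⇒m<1+n; m≤m+n; m≤n+m; m≤n⇒m≤1+n; +-monoʳ-≤; +-identityʳ; +-suc; module ≤-Reasoning)
open import Data.Nat.Tactic.RingSolver using (solve-∀)
open import Data.List using (List; []; _∷_; _++_; [_]; length; deduplicate; upTo)
open import Data.List.Properties using (length-++; ++-assoc; ++-identityʳ; length-upTo; length-removeAt′)
open import Data.List.Membership.Propositional using (_∈_; _∉_)
open import Data.List.Membership.Propositional.Properties using (∈-++⁺ʳ; ∈-++⁻; ∈-upTo⁺; ∈-deduplicate⁻)
open import Data.List.Membership.DecPropositional _≟_ using (_∈?_)
open import Data.List.Relation.Binary.Subset.Propositional using (_⊆_)
open import Data.List.Relation.Unary.Any as Any using (here; there; _─_)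
open import Data.List.Relation.Unary.All as All using (All)
open import Data.List.Relation.Unary.All.Properties using (¬Any⇒All¬)
open import Data.List.Relation.Unary.AllPairs using ([]; _∷_)
open import Data.List.Relation.Unary.Unique.Propositional using (Unique)
import Data.List.Relation.Unary.Unique.DecPropositional.Properties as UniqueDec
open import Data.Vec using (Vec; []; _∷_; _∷ʳ_; lookup)
open import Data.Vec.Properties using (last-∷ʳ)
open import Data.Vec.Relation.Unary.Any as AnyVec using () renaming (Any to Anyᵥ)
open import Data.Vec.Membership.Propositional using (lose)
open import Data.Vec.Membership.Propositional.Properties using (∈-lookup)
open import Data.Product using (∃-syntax; _×_; _,_; proj₁; proj₂)
open import Data.Sum using (_⊎_; inj₁; inj₂)
open import Data.Empty using (⊥-elim)
open import Function using (_∘_)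
open import Relation.Nullary using (yes; no)
open import Relation.Binary.PropositionalEquality using (_≡_; _≢_; refl; sym; trans; cong; cong₂; subst; module ≡-Reasoning)
open import Relation.Binary.Definitions using (DecidableEquality)

∈-─ : {A : Set} {x z : A} {ys : List A} (x∈ys : x ∈ ys) → z ∈ ys → z ≢ x → z ∈ (ys ─ x∈ys)
∈-─ (here refl) (here refl) z≢x = ⊥-elim (z≢x refl)
∈-─ (here refl) (there z∈ys) _  = z∈ys
∈-─ (there _)   (here z≡y)   _  = here z≡y
∈-─ (there x∈ys) (there z∈ys) z≢x = there (∈-─ x∈ys z∈ys z≢x)

unique-⊆⇒length≤ : {A : Set} {xs ys : List A} → Unique xs → xs ⊆ ys → length xs ≤ length ys
unique-⊆⇒length≤ {xs = []}     _              _     = z≤n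
unique-⊆⇒length≤ {xs = x ∷ xs} {ys} (x∉xs ∷ !xs) xs⊆ys = begin
  suc (length xs)               ≤⟨ s≤s (unique-⊆⇒length≤ !xs (λ z∈xs → ∈-─ x∈ys (xs⊆ys (there z∈xs)) (z≢x z∈xs))) ⟩
  suc (length (ys ─ x∈ys))      ≡⟨ sym (length-removeAt′ ys (Any.index x∈ys)) ⟩
  length ys                     ∎
  where
  open ≤-Reasoning
  x∈ys : x ∈ ys
  x∈ys = xs⊆ys (here refl)
  z≢x : ∀ {z} → z ∈ xs → z ≢ x
  z≢x z∈xs refl = All.lookup x∉xs z∈xs refl

module _ {A : Set} {P : A → Set} where

  Any-∷ʳ⁻ : ∀ {n} {xs : Vec A n} {x} → Anyᵥ P (xs ∷ʳ x) → Anyᵥ P xs ⊎ P x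
  Any-∷ʳ⁻ {xs = []}     (AnyVec.here px) = inj₂ px
  Any-∷ʳ⁻ {xs = _ ∷ _}  (AnyVec.here py) = inj₁ (AnyVec.here py)
  Any-∷ʳ⁻ {xs = _ ∷ xs} (AnyVec.there p) with Any-∷ʳ⁻ {xs = xs} p
  ... | inj₁ old = inj₁ (AnyVec.there old)
  ... | inj₂ new = inj₂ new

  Any-∷ʳ⁺ʳ : ∀ {n} (xs : Vec A n) {x} → P x → Anyᵥ P (xs ∷ʳ x)
  Any-∷ʳ⁺ʳ []       px = AnyVec.here px
  Any-∷ʳ⁺ʳ (_ ∷ xs) px = AnyVec.there (Any-∷ʳ⁺ʳ xs px)

module _ {A : Set} where

  infix 4 _⊑_

  data _⊑_ : DTree A → DTree A → Set where
    ⊑-refl : ∀ {t} → t ⊑ t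
    left   : ∀ {u X l r} → u ⊑ l → u ⊑ tnode X l r
    right  : ∀ {u X l r} → u ⊑ r → u ⊑ tnode X l r

  ⊑-trans : ∀ {u t v} → u ⊑ t → t ⊑ v → u ⊑ v
  ⊑-trans u⊑t ⊑-refl    = u⊑t
  ⊑-trans u⊑t (left p)  = left (⊑-trans u⊑t p)
  ⊑-trans u⊑t (right p) = right (⊑-trans u⊑t p)

  nodes : DTree A → ℕ
  nodes (tleaf _ _)   = 1
  nodes (tnode _ l r) = suc (nodes l + nodes r)

  ⊑⇒nodes≤ : ∀ {u t} → u ⊑ t → nodes u ≤ nodes t
  ⊑⇒nodes≤ ⊑-refl                  = ≤-refl
  ⊑⇒nodes≤ (left {l = l} {r} p)  = m≤n⇒m≤1+n (≤-trans (⊑⇒nodes≤ p) (m≤m+n (nodes l) (nodes r)))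
  ⊑⇒nodes≤ (right {l = l} {r} p) = m≤n⇒m≤1+n (≤-trans (⊑⇒nodes≤ p) (m≤n+m (nodes r) (nodes l)))

  record Coherent {n : ℕ} (ts : Vec (DTree A) n) : Set where
    field
      label<          : ∀ {u} → Anyᵥ (u ⊑_) ts → label u < n
      label-injective : ∀ {u v} → Anyᵥ (u ⊑_) ts → Anyᵥ (v ⊑_) ts → label u ≡ label v → u ≡ v

  coherent-∷ʳ : ∀ {n} {ts : Vec (DTree A) n} {x} → Coherent ts → label x ≡ n →
                (∀ {u} → u ⊑ x → u ≡ x ⊎ Anyᵥ (u ⊑_) ts) → Coherent (ts ∷ʳ x)
  coherent-∷ʳ {n} {ts} {x} coh x≡n subtrees-of-x = record
    { label<          = label<′
    ; label-injective = injective′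
    }
    where
    open Coherent coh
    classify : ∀ {u} → Anyᵥ (u ⊑_) (ts ∷ʳ x) → u ≡ x ⊎ Anyᵥ (u ⊑_) ts
    classify p with Any-∷ʳ⁻ p
    ... | inj₁ old = inj₂ old
    ... | inj₂ u⊑x = subtrees-of-x u⊑x
    label<′ : ∀ {u} → Anyᵥ (u ⊑_) (ts ∷ʳ x) → label u < suc n
    label<′ p with classify p
    ... | inj₁ refl = s≤s (≤-reflexive x≡n)
    ... | inj₂ old  = m<n⇒m<1+n (label< old)
    new≢old : ∀ {v} → Anyᵥ (v ⊑_) ts → label x ≢ label v
    new≢old old x≡v = <-irrefl (trans (sym x≡v) x≡n) (label< old)
    injective′ : ∀ {u v} → Anyᵥ (u ⊑_) (ts ∷ʳ x) → Anyᵥ (v ⊑_) (ts ∷ʳ x) → label u ≡ label v → u ≡ v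
    injective′ p q u≡v with classify p | classify q
    ... | inj₁ refl | inj₁ refl = refl
    ... | inj₁ refl | inj₂ old  = ⊥-elim (new≢old old u≡v)
    ... | inj₂ old  | inj₁ refl = ⊥-elim (new≢old old (sym u≡v))
    ... | inj₂ old  | inj₂ old′ = label-injective old old′ u≡v

  coherent-trees : ∀ {n} (G : SLP A n) → Coherent (trees G)
  coherent-trees []                    = record { label< = λ () ; label-injective = λ () }
  coherent-trees (G ▷ term a)          = coherent-∷ʳ (coherent-trees G) refl λ { ⊑-refl → inj₁ refl }
  coherent-trees {suc n} (G ▷ bin j k) = coherent-∷ʳ (coherent-trees G) refl subtrees
    where
    subtrees : ∀ {u} → u ⊑ tnode n (lookup (trees G) j) (lookup (trees G) k) →
               u ≡ tnode n (lookup (trees G) j) (lookup (trees G) k) ⊎ Anyᵥ (u ⊑_) (trees G)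
    subtrees ⊑-refl    = inj₁ refl
    subtrees (left p)  = inj₂ (lose (∈-lookup j (trees G)) p)
    subtrees (right p) = inj₂ (lose (∈-lookup k (trees G)) p)

  ⊑-derivTree⇒Any : ∀ {n} (G : SLP A (suc n)) {u} → u ⊑ derivTree G → Anyᵥ (u ⊑_) (trees G)
  ⊑-derivTree⇒Any (G ▷ _) p = Any-∷ʳ⁺ʳ (trees G) (subst (_ ⊑_) (last-∷ʳ _ (trees G)) p)

  derivTree-label< : ∀ {n} (G : SLP A (suc n)) {u} → u ⊑ derivTree G → label u < suc n
  derivTree-label< G u⊑T = Coherent.label< (coherent-trees G) (⊑-derivTree⇒Any G u⊑T)

  derivTree-consistent : ∀ {n} (G : SLP A (suc n)) {u v} → u ⊑ derivTree G → v ⊑ derivTree G →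
                         label u ≡ label v → u ≡ v
  derivTree-consistent G u⊑T v⊑T =
    Coherent.label-injective (coherent-trees G) (⊑-derivTree⇒Any G u⊑T) (⊑-derivTree⇒Any G v⊑T)

module Traversal {A : Set} (T : DTree A)
                 (consistent : ∀ {u v} → u ⊑ T → v ⊑ T → label u ≡ label v → u ≡ v) where

  Witnessed : List A → ℕ → Set
  Witnessed F Y = ∃[ u ] u ⊑ T × label u ≡ Y × yield u ⊆ F

  -- P holds the labels of the ancestors whose traversal is still in progress.
  Accounted : List ℕ → List A → List ℕ → Set
  Accounted P F s = ∀ {Y} → Y ∈ s → Y ∈ P ⊎ Witnessed F Y

  Fresh : List ℕ → DTree A → Set
  Fresh P t = ∀ {u} → u ⊑ t → label u ∉ P

  -- new holds the symbols of the terminal leaves of PT(G) inside t and internal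
  -- counts its internal nodes; every label added to s is one of these nodes.
  record Visit (P s : List ℕ) (F : List A) (t : DTree A) (result : List ℕ × List (List A)) : Set where
    field
      new       : List A
      internal  : ℕ
      phrases   : length (proj₂ result) ≡ suc internal
      visited   : internal + length new + length s ≡ length (proj₁ result)
      unique    : Unique (proj₁ result)
      accounted : Accounted P (new ++ F) (proj₁ result)
      covered   : yield t ⊆ new ++ F
  open Visit

  witnessed-mono : ∀ {F F′ Y} → F ⊆ F′ → Witnessed F Y → Witnessed F′ Y
  witnessed-mono F⊆F′ (u , u⊑T , u≡Y , yu⊆F) = u , u⊑T , u≡Y , F⊆F′ ∘ yu⊆F

  accounted-push : ∀ {P F s} X → Accounted P F s → Accounted (X ∷ P) F (X ∷ s)
  accounted-push X acc (here refl) = inj₁ (here refl)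
  accounted-push X acc (there Y∈s) with acc Y∈s
  ... | inj₁ Y∈P = inj₁ (there Y∈P)
  ... | inj₂ wit = inj₂ wit

  -- A child c of t cannot contain a subtree labelled like t: by consistency it would be t itself.
  fresh-child : ∀ {P t c} → t ⊑ T → Fresh P t → (∀ {u} → u ⊑ c → u ⊑ t) → nodes c < nodes t →
                Fresh (label t ∷ P) c
  fresh-child t⊑T fresh c⊆t c<t u⊑c (here u≡t) with consistent (⊑-trans (c⊆t u⊑c) t⊑T) t⊑T u≡t
  ... | refl = <-irrefl refl (≤-trans c<t (⊑⇒nodes≤ u⊑c))
  fresh-child t⊑T fresh c⊆t c<t u⊑c (there u∈P) = fresh (c⊆t u⊑c) u∈P

  visit-seen : ∀ {P s F t} → t ⊑ T → Fresh P t → Unique s → Accounted P F s → label t ∈ s →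
               Visit P s F t (s , [ yield t ])
  visit-seen {P} {s} {F} {t} t⊑T fresh !s acc t∈s = record
    { new = [] ; internal = 0 ; phrases = refl ; visited = refl ; unique = !s ; accounted = acc
    ; covered = covered′ }
    where
    covered′ : yield t ⊆ F
    covered′ with acc t∈s
    ... | inj₁ t∈P = ⊥-elim (fresh ⊑-refl t∈P)
    ... | inj₂ (u , u⊑T , u≡t , yu⊆F) with consistent u⊑T t⊑T u≡t
    ... | refl = yu⊆F

  visit-tleaf : ∀ {P s F X a} → tleaf X a ⊑ T → Unique s → Accounted P F s → X ∉ s →
                Visit P s F (tleaf X a) (X ∷ s , [ a ∷ [] ])
  visit-tleaf {P} {s} {F} {X} {a} leaf⊑T !s acc X∉s = record
    { new = a ∷ [] ; internal = 0 ; phrases = refl ; visited = refl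
    ; unique = ¬Any⇒All¬ s X∉s ∷ !s ; accounted = accounted′ ; covered = λ { (here refl) → here refl } }
    where
    accounted′ : Accounted P (a ∷ F) (X ∷ s)
    accounted′ (here refl) = inj₂ (tleaf X a , leaf⊑T , refl , λ { (here refl) → here refl })
    accounted′ (there Y∈s) with acc Y∈s
    ... | inj₁ Y∈P = inj₁ Y∈P
    ... | inj₂ wit = inj₂ (witnessed-mono there wit)

  visit-tnode : ∀ {P s F X l r s₁ ps₁ s₂ ps₂} → tnode X l r ⊑ T →
                (v₁ : Visit (X ∷ P) (X ∷ s) F l (s₁ , ps₁)) →
                Visit (X ∷ P) s₁ (new v₁ ++ F) r (s₂ , ps₂) →
                Visit P s F (tnode X l r) (s₂ , ps₁ ++ ps₂)
  visit-tnode {P} {s} {F} {X} {l} {r} {s₁} {ps₁} {s₂} {ps₂} t⊑T v₁ v₂ = record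
    { new = new v₂ ++ new v₁
    ; internal = suc (internal v₁ + internal v₂)
    ; phrases = phrases′
    ; visited = visited′
    ; unique = unique v₂
    ; accounted = accounted′
    ; covered = covered′
    }
    where
    F′ : List A
    F′ = (new v₂ ++ new v₁) ++ F
    reassoc : new v₂ ++ (new v₁ ++ F) ⊆ F′
    reassoc = subst (_ ∈_) (sym (++-assoc (new v₂) (new v₁) F))
    phrases′ : length (ps₁ ++ ps₂) ≡ suc (suc (internal v₁ + internal v₂))
    phrases′ = trans (length-++ ps₁) (trans (cong₂ _+_ (phrases v₁) (phrases v₂))
                                              (cong suc (+-suc (internal v₁) (internal v₂))))
    visited′ : suc (internal v₁ + internal v₂) + length (new v₂ ++ new v₁) + length s ≡ length s₂
    visited′ = begin
      suc (internal v₁ + internal v₂) + length (new v₂ ++ new v₁) + length s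
        ≡⟨ cong (λ k → suc (internal v₁ + internal v₂) + k + length s) (length-++ (new v₂)) ⟩
      suc (internal v₁ + internal v₂) + (length (new v₂) + length (new v₁)) + length s
        ≡⟨ regroup (internal v₁) (internal v₂) (length (new v₁)) (length (new v₂)) (length s) ⟩
      internal v₂ + length (new v₂) + (internal v₁ + length (new v₁) + length (X ∷ s))
        ≡⟨ cong (internal v₂ + length (new v₂) +_) (visited v₁) ⟩
      internal v₂ + length (new v₂) + length s₁
        ≡⟨ visited v₂ ⟩
      length s₂ ∎
      where
      open ≡-Reasoning
      regroup : ∀ i₁ i₂ n₁ n₂ m → suc (i₁ + i₂) + (n₂ + n₁) + m ≡ i₂ + n₂ + (i₁ + n₁ + suc m)
      regroup = solve-∀
    covered′ : yield l ++ yield r ⊆ F′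
    covered′ y∈lr with ∈-++⁻ (yield l) y∈lr
    ... | inj₁ y∈l = reassoc (∈-++⁺ʳ (new v₂) (covered v₁ y∈l))
    ... | inj₂ y∈r = reassoc (covered v₂ y∈r)
    accounted′ : Accounted P F′ s₂
    accounted′ Y∈s₂ with accounted v₂ Y∈s₂
    ... | inj₁ (here refl) = inj₂ (tnode X l r , t⊑T , refl , covered′)
    ... | inj₁ (there Y∈P) = inj₁ Y∈P
    ... | inj₂ wit         = inj₂ (witnessed-mono reassoc wit)

  traverse : ∀ P s F t → t ⊑ T → Fresh P t → Unique s → Accounted P F s → Visit P s F t (gfactGo s t)
  traverse P s F t t⊑T fresh !s acc with label t ∈? s
  ... | yes t∈s = visit-seen t⊑T fresh !s acc t∈s
  traverse P s F (tleaf X a) t⊑T fresh !s acc | no X∉s = visit-tleaf t⊑T !s acc X∉s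
  traverse P s F (tnode X l r) t⊑T fresh !s acc | no X∉s
    with gfactGo (X ∷ s) l
       | traverse (X ∷ P) (X ∷ s) F l (⊑-trans (left ⊑-refl) t⊑T)
                  (fresh-child t⊑T fresh left (s≤s (m≤m+n (nodes l) (nodes r))))
                  (¬Any⇒All¬ s X∉s ∷ !s) (accounted-push X acc)
  ... | s₁ , ps₁ | v₁
    with gfactGo s₁ r
       | traverse (X ∷ P) s₁ (new v₁ ++ F) r (⊑-trans (right ⊑-refl) t⊑T)
                  (fresh-child t⊑T fresh right (s≤s (m≤n+m (nodes r) (nodes l))))
                  (unique v₁) (accounted v₁)
  ... | s₂ , ps₂ | v₂ = visit-tnode t⊑T v₁ v₂

lemma5 : {A : Set} (_≟A_ : DecidableEquality A) {n : ℕ} (G : SLP A (suc n)) (w : List A) →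
    w ≢ [] → Derives G w →
    length (gfact G) ∸ 1 + σ _≟A_ w ≤ size G
lemma5 _≟A_ {n} G w _ derives
  with gfactGo [] (derivTree G)
     | Traversal.traverse (derivTree G) (derivTree-consistent G) [] [] [] (derivTree G) ⊑-refl (λ _ ()) [] (λ ())
... | s , ps | v = begin
  length ps ∸ 1 + σ _≟A_ w   ≡⟨ cong (λ k → k ∸ 1 + σ _≟A_ w) phrases ⟩
  internal + σ _≟A_ w        ≤⟨ +-monoʳ-≤ internal σ≤new ⟩
  internal + length new      ≡⟨ trans (sym (+-identityʳ _)) visited ⟩
  length s                   ≤⟨ visited≤ ⟩
  suc n                      ∎
  where
  open ≤-Reasoning
  open Traversal (derivTree G) (derivTree-consistent G)
  open Visit v
  σ≤new : σ _≟A_ w ≤ length new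
  σ≤new = ≤-trans (unique-⊆⇒length≤ (UniqueDec.deduplicate-! _≟A_ w)
                     (covered ∘ subst (_ ∈_) (sym derives) ∘ ∈-deduplicate⁻ _≟A_ w))
                  (≤-reflexive (cong length (++-identityʳ new)))
  visited≤ : length s ≤ suc n
  visited≤ = ≤-trans (unique-⊆⇒length≤ unique s⊆labels) (≤-reflexive (length-upTo (suc n)))
    where
    s⊆labels : s ⊆ upTo (suc n)
    s⊆labels Y∈s with accounted Y∈s
    ... | inj₂ (u , u⊑T , refl , _) = ∈-upTo⁺ (derivTree-label< G u⊑T)
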